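{- Let $W=\langle K,\le,D,J,v\rangle$ be a strict finitistic model. (i) If $W$ has the atomic prevalence property, then it has the formula prevalence property. (ii) The following are equivalent: (a) $W$ has the atomic prevalence property; (b) $\models^V_W\neg\neg P\to P$ for every closed atomic $\mathcal{L}(D)$-formula $P$; (c) $\models^V_W(P\to Q)\to((P\to\neg Q)\to\neg P)$ for all closed atomic $\mathcal{L}(D)$-formulas $P,Q$.
   Context: Language: $\mathcal{L}$ is a first-order language with $\top,\bot$, connectives $\land,\lor,\to,\neg$ ($\neg$ primitive, distinct from $A\to\bot$), $\forall,\exists$, countably many variables, constants, function and predicate symbols, including a distinguished unary predicate $E$. $\mathcal{L}(D)$ adds constants $\overline d$ for $d\in D$. GN formulas: $N::=\bot\mid\neg A\mid N\land N\mid N\lor N\mid N\to N\mid\forall xN\mid\exists xN$; $\forall xA$/$\exists xA$ is global if $x$ occurs free in $A$ and all its free occurrences lie inside GN subformulas, local otherwise. Strict finitistic model $W=\langle K,\le,D,J,v\rangle$: rooted tree (countable branching, height $\le\omega$), nonempty constant domain $D$, compositional interpretation $J$ of closed $\mathcal{L}(D)$-terms with $J(\overline d)=d$, monotone extensions $P^{v(k)}\subseteq D^n$, strictness (values of all subterms of arguments of an atom true at a node lie in $E$'s extension there), finite verification (finitely many predicates with nonempty extension per node). Forcing: atoms via $v(k)$; $\top$ forced, $\bot$ not; $\land,\lor$ componentwise; $k\models A\to B$ iff every $k'\ge k$ forcing $A$ has some $k''\ge k'$ forcing $B$; $k\models\neg A$ iff no node forces $A$; $k\models\forall xA$ iff for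 all $d$, $k\models\top\to A[\overline d/x]$ (global) or $k\models E(\overline d)\to A[\overline d/x]$ (local); $k\models\exists xA$ iff for some $d$, $k\models A[\overline d/x]$ (global) or $k\models E(\overline d)\land A[\overline d/x]$ (local). A closed formula is valid ($\models^V_W$) if forced at all nodes, assertible if forced at some node, prevalent if every node $k$ has some $k'\ge k$ forcing it. Formula prevalence property: every assertible closed $\mathcal{L}(D)$-formula is prevalent. Atomic prevalence property: every assertible closed atomic $\mathcal{L}(D)$-formula (including those of the form $E(c)$) is prevalent. -}

module Defs where

open import Data.Nat using (ℕ; zero; suc; _+_; _≡ᵇ_)
open import Data.Bool using (Bool; true; false; _∧_; _∨_; not; if_then_else_)
open import Data.Maybe using (Maybe; just; nothing)
open import Data.Vec using (Vec; []; _∷_; lookup; map)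
open import Data.Fin using (Fin)
open import Data.List using (List)
open import Data.List.Membership.Propositional using (_∈_)
open import Data.Product using (Σ; Σ-syntax; _×_; _,_)
open import Data.Sum using (_⊎_)
open import Data.Empty using (⊥)
open import Data.Unit using (⊤)
open import Relation.Nullary using (¬_)
open import Relation.Binary.PropositionalEquality using (_≡_; _≢_)

Countable : Set → Set
Countable X = Σ (X → ℕ) λ f → ∀ a b → f a ≡ f b → a ≡ b

-- Constants, function
-- symbols and (non-distinguished) predicate symbols form countable sets;
-- the distinguished unary predicate E is added separately.

record Signature : Set₁ where
  field
    Const    : Set
    Fun      : Set
    funAr    : Fun → ℕ
    PSym     : Set
    psymAr   : PSym → ℕ
    constCountable : Countable Const
    funCountable   : Countable Fun
    psymCountable  : Countable PSym

module Syntax (S : Signature) where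
  open Signature S

  data Pred : Set where
    E   : Pred
    sym : PSym → Pred

  ar : Pred → ℕ
  ar E       = 1
  ar (sym p) = psymAr p

  data Term (D : Set) : Set where
    var : ℕ → Term D
    dc  : D → Term D
    con : Const → Term D
    app : (f : Fun) → Vec (Term D) (funAr f) → Term D

  data CTerm (D : Set) : Set where
    dc  : D → CTerm D
    con : Const → CTerm D
    app : (f : Fun) → Vec (CTerm D) (funAr f) → CTerm D

  data _⊑_ {D : Set} : CTerm D → CTerm D → Set where
    here : ∀ {t} → t ⊑ t
    there : ∀ {s f ts} (i : Fin (funAr f)) → s ⊑ lookup ts i → s ⊑ app f ts

  mutual
    embed : ∀ {D} → CTerm D → Term D
    embed (dc d) = dc d
    embed (con c) = con c
    embed (app f ts) = app f (embeds ts)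

    embeds : ∀ {D n} → Vec (CTerm D) n → Vec (Term D) n
    embeds [] = []
    embeds (t ∷ ts) = embed t ∷ embeds ts

  mutual
    close : ∀ {D} → Term D → Maybe (CTerm D)
    close (var x) = nothing
    close (dc d) = just (dc d)
    close (con c) = just (con c)
    close (app f ts) with closes ts
    ... | just cts = just (app f cts)
    ... | nothing  = nothing

    closes : ∀ {D n} → Vec (Term D) n → Maybe (Vec (CTerm D) n)
    closes [] = just []
    closes (t ∷ ts) with close t | closes ts
    ... | just c | just cs = just (c ∷ cs)
    ... | _      | _       = nothing

  data Formula (D : Set) : Set where
    atom : (P : Pred) → Vec (Term D) (ar P) → Formula D
    ⊤'   : Formula D
    ⊥'   : Formula D
    _∧'_ : Formula D → Formula D → Formula D
    _∨'_ : Formula D → Formula D → Formula D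
    _⇒_  : Formula D → Formula D → Formula D
    ¬'_  : Formula D → Formula D
    all  : ℕ → Formula D → Formula D
    ex   : ℕ → Formula D → Formula D

  mutual
    freeT : ∀ {D} → ℕ → Term D → Bool
    freeT x (var y) = x ≡ᵇ y
    freeT x (dc d) = false
    freeT x (con c) = false
    freeT x (app f ts) = freeTs x ts

    freeTs : ∀ {D n} → ℕ → Vec (Term D) n → Bool
    freeTs x [] = false
    freeTs x (t ∷ ts) = freeT x t ∨ freeTs x ts

  freeIn : ∀ {D} → ℕ → Formula D → Bool
  freeIn x (atom P ts) = freeTs x ts
  freeIn x ⊤' = false
  freeIn x ⊥' = false
  freeIn x (A ∧' B) = freeIn x A ∨ freeIn x B
  freeIn x (A ∨' B) = freeIn x A ∨ freeIn x B
  freeIn x (A ⇒ B) = freeIn x A ∨ freeIn x B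
  freeIn x (¬' A) = freeIn x A
  freeIn x (all y A) = if x ≡ᵇ y then false else freeIn x A
  freeIn x (ex y A) = if x ≡ᵇ y then false else freeIn x A

  Closed : ∀ {D} → Formula D → Set
  Closed A = ∀ x → freeIn x A ≡ false

  isGN : ∀ {D} → Formula D → Bool
  isGN (atom P ts) = false
  isGN ⊤' = false
  isGN ⊥' = true
  isGN (A ∧' B) = isGN A ∧ isGN B
  isGN (A ∨' B) = isGN A ∧ isGN B
  isGN (A ⇒ B) = isGN A ∧ isGN B
  isGN (¬' A) = true
  isGN (all y A) = isGN A
  isGN (ex y A) = isGN A

  mutual
    occGN : ∀ {D} → ℕ → Formula D → Bool
    occGN x A = if isGN A then true else occGN' x A

    occGN' : ∀ {D} → ℕ → Formula D → Bool
    occGN' x (atom P ts) = not (freeTs x ts)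
    occGN' x ⊤' = true
    occGN' x ⊥' = true
    occGN' x (A ∧' B) = occGN x A ∧ occGN x B
    occGN' x (A ∨' B) = occGN x A ∧ occGN x B
    occGN' x (A ⇒ B) = occGN x A ∧ occGN x B
    occGN' x (¬' A) = true
    occGN' x (all y A) = if x ≡ᵇ y then true else occGN x A
    occGN' x (ex y A) = if x ≡ᵇ y then true else occGN x A

  isGlobal : ∀ {D} → ℕ → Formula D → Bool
  isGlobal x A = freeIn x A ∧ occGN x A

  mutual
    subT : ∀ {D} → ℕ → D → Term D → Term D
    subT x d (var y) = if x ≡ᵇ y then dc d else var y
    subT x d (dc e) = dc e
    subT x d (con c) = con c
    subT x d (app f ts) = app f (subTs x d ts)

    subTs : ∀ {D n} → ℕ → D → Vec (Term D) n → Vec (Term D) n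
    subTs x d [] = []
    subTs x d (t ∷ ts) = subT x d t ∷ subTs x d ts

  sub : ∀ {D} → ℕ → D → Formula D → Formula D
  sub x d (atom P ts) = atom P (subTs x d ts)
  sub x d ⊤' = ⊤'
  sub x d ⊥' = ⊥'
  sub x d (A ∧' B) = sub x d A ∧' sub x d B
  sub x d (A ∨' B) = sub x d A ∨' sub x d B
  sub x d (A ⇒ B) = sub x d A ⇒ sub x d B
  sub x d (¬' A) = ¬' sub x d A
  sub x d (all y A) = if x ≡ᵇ y then all y A else all y (sub x d A)
  sub x d (ex y A) = if x ≡ᵇ y then ex y A else ex y (sub x d A)

  -- size, used as fuel for the forcing clauses (substitution preserves it)
  size : ∀ {D} → Formula D → ℕ
  size (atom P ts) = 1
  size ⊤' = 1
  size ⊥' = 1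
  size (A ∧' B) = suc (size A + size B)
  size (A ∨' B) = suc (size A + size B)
  size (A ⇒ B) = suc (size A + size B)
  size (¬' A) = suc (size A)
  size (all x A) = suc (suc (suc (size A)))
  size (ex x A) = suc (suc (suc (size A)))

module Models (S : Signature) where
  open Signature S
  open Syntax S

  record StrictFinitisticModel : Set₁ where
    field
      K      : Set
      _≤_    : K → K → Set
      ≤-refl  : ∀ k → k ≤ k
      ≤-trans : ∀ {a b c} → a ≤ b → b ≤ c → a ≤ c
      ≤-antisym : ∀ {a b} → a ≤ b → b ≤ a → a ≡ b
      root   : K
      root-≤ : ∀ k → root ≤ k
      tree   : ∀ {a b k} → a ≤ k → b ≤ k → (a ≤ b) ⊎ (b ≤ a)
      -- height ≤ ω: every node has finitely many predecessors
      finPred : ∀ k → Σ (List K) λ l → ∀ a → a ≤ k → a ∈ l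
      -- countable branching: the immediate successors of each node
      -- form a countable set
      countBranch : ∀ k → Countable (Σ K λ k' →
                        (k ≤ k') × (k ≢ k') ×
                        (∀ m → k ≤ m → m ≤ k' → (m ≡ k) ⊎ (m ≡ k')))
      D      : Set
      d₀     : D
      -- compositional interpretation J (given by its values on the
      -- constants and function symbols; J(d̄) = d, see below)
      constI : Const → D
      funI   : (f : Fun) → Vec D (funAr f) → D
      v      : K → (P : Pred) → Vec D (ar P) → Set
      mono   : ∀ {k k'} P ds → k ≤ k' → v k P ds → v k' P ds

    mutual
      J : CTerm D → D
      J (dc d) = d
      J (con c) = constI c
      J (app f ts) = funI f (Js ts)

      Js : ∀ {n} → Vec (CTerm D) n → Vec D n
      Js [] = []
      Js (t ∷ ts) = J t ∷ Js ts

  record IsStrictFinitistic (M : StrictFinitisticModel) : Set₁ where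
    open StrictFinitisticModel M
    field
      strict : ∀ k P (cts : Vec (CTerm D) (ar P)) → v k P (Js cts) →
               ∀ (i : Fin (ar P)) s → s ⊑ lookup cts i → v k E (J s ∷ [])
      finVer : ∀ k → Σ (List Pred) λ ps → ∀ P ds → v k P ds → P ∈ ps

  module Forcing (M : StrictFinitisticModel) where
    open StrictFinitisticModel M

    AtomTrue : K → (P : Pred) → Vec (Term D) (ar P) → Set
    AtomTrue k P ts = Σ (Vec (CTerm D) (ar P)) λ cts →
                        (closes ts ≡ just cts) × v k P (Js cts)

    F : ℕ → K → Formula D → Set
    F zero k A = ⊥
    F (suc n) k (atom P ts) = AtomTrue k P ts
    F (suc n) k ⊤' = ⊤
    F (suc n) k ⊥' = ⊥
    F (suc n) k (A ∧' B) = F n k A × F n k B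
    F (suc n) k (A ∨' B) = F n k A ⊎ F n k B
    F (suc n) k (A ⇒ B) =
      ∀ k' → k ≤ k' → F n k' A → Σ K λ k'' → (k' ≤ k'') × F n k'' B
    F (suc n) k (¬' A) = ∀ k' → ¬ F n k' A
    F (suc n) k (all x A) with isGlobal x A
    ... | true  = ∀ d → F n k (⊤' ⇒ sub x d A)
    ... | false = ∀ d → F n k (atom E (dc d ∷ []) ⇒ sub x d A)
    F (suc n) k (ex x A) with isGlobal x A
    ... | true  = Σ D λ d → F n k (sub x d A)
    ... | false = Σ D λ d → F n k (atom E (dc d ∷ []) ∧' sub x d A)

    _⊩_ : K → Formula D → Set
    k ⊩ A = F (size A) k A

    Valid Assertible Prevalent : Formula D → Set
    Valid A = ∀ k → k ⊩ A
    Assertible A = Σ K λ k → k ⊩ A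
    Prevalent A = ∀ k → Σ K λ k' → (k ≤ k') × (k' ⊩ A)

    FormulaPrevalence : Set
    FormulaPrevalence = ∀ A → Closed A → Assertible A → Prevalent A

    ClosedAtom : (P : Pred) → Vec (CTerm D) (ar P) → Formula D
    ClosedAtom P cts = atom P (embeds cts)

    AtomicPrevalence : Set
    AtomicPrevalence = ∀ P cts →
      Assertible (ClosedAtom P cts) → Prevalent (ClosedAtom P cts)

    StabilityValid : Set
    StabilityValid = ∀ P cts →
      Valid ((¬' (¬' ClosedAtom P cts)) ⇒ ClosedAtom P cts)

    NegIntroValid : Set
    NegIntroValid = ∀ P cts Q cts' →
      Valid ((ClosedAtom P cts ⇒ ClosedAtom Q cts') ⇒
             ((ClosedAtom P cts ⇒ (¬' ClosedAtom Q cts')) ⇒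
              (¬' ClosedAtom P cts)))

ExcludedMiddle : Set₁
ExcludedMiddle = ∀ (A : Set) → A ⊎ ¬ A

{-# OPTIONS --safe #-}
-- Forcing is monotone, and a negation is forced either at every node or at
-- none.  If atoms are prevalent, then an implication forced at a node k is
-- forced at every node m: an antecedent forced above m is carried above k by
-- prevalence, and the consequent found there is carried back above m.  By
-- induction on the fuel, every forced formula is then prevalent; validity of
-- forced implications is carried along, since a universal formula is forced
-- by forcing a family of implications at the same node.  For (ii),
-- ¬¬P is forced exactly when P is (classically) assertible, so stability of
-- atoms is atomic prevalence; and in the instance (P → P) → ((P → ¬P) → ¬P)
-- of negation introduction, P → ¬P holds vacuously at nodes with no P above
-- them, which forces ¬P and so contradicts assertibility of P.
module Submission where

open import Defs
open import Data.Product using (_×_; Σ; _,_; proj₁)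
open import Data.Sum using (inj₁; inj₂)
open import Data.Empty using (⊥-elim)
open import Data.Unit using (tt)
open import Data.Bool using (true; false)
open import Data.Nat using (ℕ; zero; suc)
open import Data.Vec using (Vec; []; _∷_)
open import Data.Maybe using (just)
open import Data.Maybe.Properties using (just-injective)
open import Relation.Binary.PropositionalEquality using (_≡_; refl; sym; trans; subst)
open import Function.Bundles using (_⇔_; mk⇔)
open import Relation.Nullary using (¬_)

module Prevalence (S : Signature) (W : Models.StrictFinitisticModel S) where
  open Syntax S hiding (sym)
  open Models S
  open StrictFinitisticModel W
  open Forcing W

  mutual
    close-embed : (t : CTerm D) → close (embed t) ≡ just t
    close-embed (dc d)     = refl
    close-embed (con c)    = refl
    close-embed (app f ts) rewrite closes-embeds ts = refl

    closes-embeds : ∀ {n} (ts : Vec (CTerm D) n) → closes (embeds ts) ≡ just ts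
    closes-embeds []       = refl
    closes-embeds (t ∷ ts) rewrite close-embed t | closes-embeds ts = refl

  forces-closedAtom : ∀ {k} P cts → v k P (Js cts) → k ⊩ ClosedAtom P cts
  forces-closedAtom P cts x = cts , closes-embeds cts , x

  closedAtom-forced : ∀ {k} P cts → k ⊩ ClosedAtom P cts → v k P (Js cts)
  closedAtom-forced {k} P cts (_ , eq , x) =
    subst (λ c → v k P (Js c)) (just-injective (trans (sym eq) (closes-embeds cts))) x

  F-mono : ∀ n A {k k′} → k ≤ k′ → F n k A → F n k′ A
  F-mono zero    A           le ()
  F-mono (suc n) (atom P ts) le (cts , eq , x) = cts , eq , mono P (Js cts) le x
  F-mono (suc n) ⊤'          le tt = tt
  F-mono (suc n) ⊥'          le ()
  F-mono (suc n) (A ∧' B)    le (a , b) = F-mono n A le a , F-mono n B le b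
  F-mono (suc n) (A ∨' B)    le (inj₁ a) = inj₁ (F-mono n A le a)
  F-mono (suc n) (A ∨' B)    le (inj₂ b) = inj₂ (F-mono n B le b)
  F-mono (suc n) (A ⇒ B)     le h k″ le′ = h k″ (≤-trans le le′)
  F-mono (suc n) (¬' A)      le h = h
  F-mono (suc n) (all x A)   le h with isGlobal x A
  ... | true  = λ d → F-mono n (⊤' ⇒ sub x d A) le (h d)
  ... | false = λ d → F-mono n (atom E (dc d ∷ []) ⇒ sub x d A) le (h d)
  F-mono (suc n) (ex x A)    le h with isGlobal x A | h
  ... | true  | d , h′ = d , F-mono n (sub x d A) le h′
  ... | false | d , h′ = d , F-mono n (atom E (dc d ∷ []) ∧' sub x d A) le h′

  PrevalentAt : ℕ → Formula D → Set
  PrevalentAt n A = ∀ k → Σ K λ k′ → (k ≤ k′) × F n k′ A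

  ForcedPrevalentAt : ℕ → Set
  ForcedPrevalentAt n = ∀ A k → F n k A → PrevalentAt n A

  ImplicationsValidAt : ℕ → Set
  ImplicationsValidAt n = ∀ A B {k} → F n k (A ⇒ B) → ∀ m → F n m (A ⇒ B)

  implicationsValidAt-suc : ∀ n → ForcedPrevalentAt n → ImplicationsValidAt (suc n)
  implicationsValidAt-suc n prev A B {k} h m m′ le a with prev A m′ a k
  ... | k₁ , k≤k₁ , a₁ with h k₁ k≤k₁ a₁
  ... | k₂ , _ , b₂ = prev B k₂ b₂ m′

  module _ (atomic : AtomicPrevalence) where

    forcedPrevalentAt-suc : ∀ {n} → ForcedPrevalentAt n → ImplicationsValidAt n →
                            ForcedPrevalentAt (suc n)
    forcedPrevalentAt-suc prev imp (atom P ts) k (cts , eq , x) m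
      with atomic P cts (k , forces-closedAtom P cts x) m
    ... | m′ , le , h = m′ , le , cts , eq , closedAtom-forced P cts h
    forcedPrevalentAt-suc prev imp ⊤' k tt m = m , ≤-refl m , tt
    forcedPrevalentAt-suc {n} prev imp (A ∧' B) k (a , b) m with prev A k a m
    ... | m₁ , le₁ , a₁ with prev B k b m₁
    ... | m₂ , le₂ , b₂ = m₂ , ≤-trans le₁ le₂ , F-mono n A le₂ a₁ , b₂
    forcedPrevalentAt-suc prev imp (A ∨' B) k (inj₁ a) m with prev A k a m
    ... | m₁ , le₁ , a₁ = m₁ , le₁ , inj₁ a₁
    forcedPrevalentAt-suc prev imp (A ∨' B) k (inj₂ b) m with prev B k b m
    ... | m₁ , le₁ , b₁ = m₁ , le₁ , inj₂ b₁
    forcedPrevalentAt-suc {n} prev imp (A ⇒ B) k h m =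
      m , ≤-refl m , implicationsValidAt-suc n prev A B h m
    forcedPrevalentAt-suc prev imp (¬' A) k h m = m , ≤-refl m , h
    forcedPrevalentAt-suc prev imp (all x A) k h m with isGlobal x A
    ... | true  = m , ≤-refl m , λ d → imp ⊤' (sub x d A) (h d) m
    ... | false = m , ≤-refl m , λ d → imp (atom E (dc d ∷ [])) (sub x d A) (h d) m
    forcedPrevalentAt-suc prev imp (ex x A) k h m with isGlobal x A | h
    ... | true  | d , h′ =
      let m′ , le , h″ = prev (sub x d A) k h′ m in m′ , le , d , h″
    ... | false | d , h′ =
      let m′ , le , h″ = prev (atom E (dc d ∷ []) ∧' sub x d A) k h′ m in m′ , le , d , h″

    forcedPrevalent : ∀ n → ForcedPrevalentAt n × ImplicationsValidAt n
    forcedPrevalent zero    = (λ _ _ ()) , λ _ _ ()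
    forcedPrevalent (suc n) =
      let prev , imp = forcedPrevalent n
      in forcedPrevalentAt-suc prev imp , implicationsValidAt-suc n prev

    formulaPrevalence : FormulaPrevalence
    formulaPrevalence A _ (k , h) = proj₁ (forcedPrevalent (size A)) A k h

  atomicPrevalence⇒stabilityValid : ExcludedMiddle → AtomicPrevalence → StabilityValid
  atomicPrevalence⇒stabilityValid em atomic P cts k k′ _ ¬¬p
    with em (Assertible (ClosedAtom P cts))
  ... | inj₁ assertible = atomic P cts assertible k′
  ... | inj₂ ¬assertible = ⊥-elim (¬¬p k λ j p → ¬assertible (j , p))

  stabilityValid⇒atomicPrevalence : StabilityValid → AtomicPrevalence
  stabilityValid⇒atomicPrevalence stable P cts (j , p) m =
    stable P cts m m (≤-refl m) λ _ ¬p → ¬p j p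

  atomicPrevalence⇒negIntroValid : AtomicPrevalence → NegIntroValid
  atomicPrevalence⇒negIntroValid atomic P cts Q cts′ k k₁ _ p⇒q =
    k₁ , ≤-refl k₁ , λ k₂ k₁≤k₂ p⇒¬q →
    k₂ , ≤-refl k₂ , clash k₂ k₁≤k₂ p⇒¬q
    where
      clash : ∀ k₂ → k₁ ≤ k₂ → k₂ ⊩ (ClosedAtom P cts ⇒ (¬' ClosedAtom Q cts′)) →
              ∀ j → ¬ (j ⊩ ClosedAtom P cts)
      clash k₂ k₁≤k₂ p⇒¬q j p with atomic P cts (j , p) k₂
      ... | k₃ , k₂≤k₃ , p₃ with p⇒¬q k₃ k₂≤k₃ p₃ | p⇒q k₃ (≤-trans k₁≤k₂ k₂≤k₃) p₃
      ... | _ , _ , ¬q | _ , _ , q = ¬q _ q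

  negIntroValid⇒atomicPrevalence : ExcludedMiddle → NegIntroValid → AtomicPrevalence
  negIntroValid⇒atomicPrevalence em negIntro P cts (j , p) m
    with em (Σ K λ m′ → (m ≤ m′) × (m′ ⊩ ClosedAtom P cts))
  ... | inj₁ above = above
  ... | inj₂ ¬above with negIntro P cts P cts m m (≤-refl m) (λ k _ p′ → k , ≤-refl k , p′)
  ... | k , m≤k , h
    with h k (≤-refl k) (λ k′ k≤k′ p′ → ⊥-elim (¬above (k′ , ≤-trans m≤k k≤k′ , p′)))
  ... | _ , _ , ¬p = ⊥-elim (¬p j p)

mainTheorem14 : ExcludedMiddle → (S : Signature) →
    (W : Models.StrictFinitisticModel S) → Models.IsStrictFinitistic S W →
    let open Models.Forcing S W in
    (AtomicPrevalence → FormulaPrevalence) ×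
    ((AtomicPrevalence ⇔ StabilityValid) × (AtomicPrevalence ⇔ NegIntroValid))
mainTheorem14 em S W _ =
  formulaPrevalence ,
  mk⇔ (atomicPrevalence⇒stabilityValid em) stabilityValid⇒atomicPrevalence ,
  mk⇔ atomicPrevalence⇒negIntroValid (negIntroValid⇒atomicPrevalence em)
  where open Prevalence S W
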